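{- If $n$ is a positive integer divisible by $8$, then $\mathrm{ex}^*(n, C_4, P_4) = 3n$.
   Context: An edge-coloring is proper if any two edges sharing a vertex receive different colors. An edge-colored subgraph is rainbow if no two of its edges have the same color. $P_4$ denotes the path with $4$ edges and $C_4$ the cycle of length $4$. $\mathrm{ex}^*(n,H,F)$ is the maximum number of rainbow copies of $H$ (as subgraphs) in an $n$-vertex simple graph with a proper edge-coloring containing no rainbow copy of $F$. -}

module Defs where

open import Data.Nat using (ℕ; _/_)
open import Data.Fin using (Fin)
open import Data.Fin.Properties using () renaming (_≟_ to _≟F_)
open import Data.Nat.Properties using () renaming (_≟_ to _≟N_)
open import Data.Bool using (Bool; true; false; _∧_; not)
open import Data.List using (List; length; filter; concatMap; [_]; [])
open import Data.List.Base using (allFin)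
open import Data.Product using (Σ; ∃; _×_; _,_)
open import Relation.Nullary using (¬_; does)
open import Relation.Nullary.Decidable using (T?)
open import Relation.Binary.PropositionalEquality using (_≡_; _≢_)

-- A finite simple graph on vertex set Fin n (symmetric, irreflexive
-- Bool-valued adjacency) together with a proper edge-colouring by natural
-- numbers (the colour of edge uv is col u v; only values on edges matter).
record ColoredGraph (n : ℕ) : Set where
  field
    adj    : Fin n → Fin n → Bool
    col    : Fin n → Fin n → ℕ
    adjSym : ∀ u v → adj u v ≡ adj v u
    irrefl : ∀ u → adj u u ≡ false
    colSym : ∀ u v → adj u v ≡ true → col u v ≡ col v u
    proper : ∀ u v w → adj u v ≡ true → adj u w ≡ true → v ≢ w →
             col u v ≢ col u w

open ColoredGraph public

RainbowP4 : ∀ {n} → ColoredGraph n → Fin n → Fin n → Fin n → Fin n → Fin n → Set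
RainbowP4 G v0 v1 v2 v3 v4 =
  (v0 ≢ v1 × v0 ≢ v2 × v0 ≢ v3 × v0 ≢ v4 × v1 ≢ v2 × v1 ≢ v3 × v1 ≢ v4 ×
   v2 ≢ v3 × v2 ≢ v4 × v3 ≢ v4) ×
  (adj G v0 v1 ≡ true × adj G v1 v2 ≡ true × adj G v2 v3 ≡ true × adj G v3 v4 ≡ true) ×
  (c1 ≢ c2 × c1 ≢ c3 × c1 ≢ c4 × c2 ≢ c3 × c2 ≢ c4 × c3 ≢ c4)
  where
  c1 = col G v0 v1
  c2 = col G v1 v2
  c3 = col G v2 v3
  c4 = col G v3 v4

HasRainbowP4 : ∀ {n} → ColoredGraph n → Set
HasRainbowP4 {n} G =
  Σ (Fin n) λ v0 → Σ (Fin n) λ v1 → Σ (Fin n) λ v2 → Σ (Fin n) λ v3 →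
  Σ (Fin n) λ v4 → RainbowP4 G v0 v1 v2 v3 v4

private
  neF : ∀ {n} → Fin n → Fin n → Bool
  neF u v = not (does (u ≟F v))
  neN : ℕ → ℕ → Bool
  neN x y = not (does (x ≟N y))

isRainbowC4 : ∀ {n} → ColoredGraph n → Fin n → Fin n → Fin n → Fin n → Bool
isRainbowC4 G a b c d =
  neF a b ∧ neF a c ∧ neF a d ∧ neF b c ∧ neF b d ∧ neF c d ∧
  adj G a b ∧ adj G b c ∧ adj G c d ∧ adj G d a ∧
  neN c1 c2 ∧ neN c1 c3 ∧ neN c1 c4 ∧ neN c2 c3 ∧ neN c2 c4 ∧ neN c3 c4
  where
  c1 = col G a b
  c2 = col G b c
  c3 = col G c d
  c4 = col G d a

rainbowC4Embeddings : ∀ {n} → ColoredGraph n → ℕ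
rainbowC4Embeddings {n} G =
  length (concatMap (λ a → concatMap (λ b → concatMap (λ c → concatMap (λ d →
    if4 (isRainbowC4 G a b c d)) (allFin n)) (allFin n)) (allFin n)) (allFin n))
  where
  if4 : Bool → List Bool
  if4 true  = [ true ]
  if4 false = []

-- Number of rainbow copies of C4 as subgraphs: each copy corresponds to
-- exactly 8 labelled cycles (|Aut(C4)| = 8).
rainbowC4Copies : ∀ {n} → ColoredGraph n → ℕ
rainbowC4Copies G = rainbowC4Embeddings G / 8

-- Upper bound: let a b c d be a rainbow C4.  Another neighbour v of a closes the path v a b c d, which is not
-- rainbow, so the colour of av repeats that of bc or cd.  By properness, the second and fourth vertices of all
-- rainbow C4s starting at a therefore lie in a set of at most four neighbours of a (if ac is an edge and both
-- repeated colours occur at a, then c is never a second vertex, since the chord would produce a rainbow P4, and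
-- c is left out).  The same argument at b leaves at most two third vertices for given second and fourth ones, so
-- at most 4·3·2 = 24 labelled rainbow C4s start at each vertex: at most 24n/8 = 3n copies of C4.
-- Lower bound: n/8 disjoint copies of a suitably coloured K₄,₄, in which every vertex starts exactly 24.
{-# OPTIONS --safe #-}
module Submission where

open import Defs
open import Data.Bool using (Bool; true; false; not; _∧_)
import Data.Bool.Properties as Bool
open import Data.Empty using (⊥-elim)
open import Data.Fin using (Fin; _↑ˡ_; _↑ʳ_; splitAt; join; toℕ; finToFun; funToFin) renaming (zero to 0F; suc to sucF)
open import Data.Fin.Properties
  using (_≟_; any?; all?; 0≢1+n; suc-injective; ↑ˡ-injective; ↑ʳ-injective;
         splitAt-↑ˡ; splitAt-↑ʳ; splitAt⁻¹-↑ˡ; splitAt⁻¹-↑ʳ; join-splitAt)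
open import Data.List using (List; []; _∷_; length; concatMap; allFin; tabulate)
open import Data.List.Membership.Propositional using (_∈_)
open import Data.List.Properties using (length-++)
open import Data.List.Relation.Unary.Any using (here; there)
open import Data.List.Relation.Unary.Any.Properties using (¬Any[])
open import Data.Nat using (ℕ; zero; suc; _+_; _*_; _/_; _<_; _≤_; z≤n; s≤s⁻¹)
open import Data.Nat.Divisibility using (_∣_; divides)
open import Data.Nat.DivMod using (m*n/n≡m; /-monoˡ-≤)
import Data.Nat.Properties as ℕ
open import Algebra.Properties.Semiring.Sum ℕ.+-*-semiring
  using (sum; sum-syntax; sum-cong-≗; sum-replicate-zero; ∑-distrib-+; ∑-comm; *-distribˡ-sum)
open import Data.Product using (Σ; ∃; _×_; _,_; proj₁)
open import Data.Sum using (_⊎_; inj₁; inj₂)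
import Data.Sum as Sum
open import Function using (_∘_; id; _⇔_; mk⇔; Equivalence)
open import Relation.Binary.Definitions using (DecidableEquality)
open import Relation.Binary.PropositionalEquality
  using (_≡_; _≢_; refl; sym; trans; cong; cong₂; subst; subst₂; ≢-sym; module ≡-Reasoning)
open import Relation.Nullary using (¬_; Dec; yes; no; does)
open import Relation.Nullary.Decidable
  using (map′; _×-dec_; _→-dec_; ¬?; T?; dec-true; dec-false; does-⇔; decidable-stable; from-yes)
open import Relation.Unary using (Decidable; ∁; _∩_)
open import Relation.Unary.Properties using (_∩?_; ∁?)

∑-mono-≤ : ∀ {n} {f g : Fin n → ℕ} → (∀ i → f i ≤ g i) → sum f ≤ sum g
∑-mono-≤ {zero}  f≤g = z≤n
∑-mono-≤ {suc n} f≤g = ℕ.+-mono-≤ (f≤g 0F) (∑-mono-≤ (f≤g ∘ sucF))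

∑-const : ∀ n c → ∑[ i < n ] c ≡ n * c
∑-const zero    c = refl
∑-const (suc n) c = cong (c +_) (∑-const n c)

term≤∑ : ∀ {n} (f : Fin n → ℕ) i → f i ≤ sum f
term≤∑ f 0F       = ℕ.m≤m+n (f 0F) _
term≤∑ f (sucF i) = ℕ.≤-trans (term≤∑ (f ∘ sucF) i) (ℕ.m≤n+m _ (f 0F))

∑-↑ : ∀ m {n} (f : Fin (m + n) → ℕ) → sum f ≡ ∑[ i < m ] f (i ↑ˡ n) + ∑[ j < n ] f (m ↑ʳ j)
∑-↑ zero    f = refl
∑-↑ (suc m) f = trans (cong (f 0F +_) (∑-↑ m (f ∘ sucF))) (sym (ℕ.+-assoc (f 0F) _ _))

length-concatMap-allFin : ∀ {n} {A : Set} (h : Fin n → List A) {f : Fin n → ℕ} →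
                          (∀ i → length (h i) ≡ f i) → length (concatMap h (allFin n)) ≡ sum f
length-concatMap-allFin h eq = trans (length-concatMap-tabulate h (λ i → i)) (sum-cong-≗ eq)
  where
  length-concatMap-tabulate : ∀ {n} {A B : Set} (h : B → List A) (g : Fin n → B) →
                              length (concatMap h (tabulate g)) ≡ ∑[ i < n ] length (h (g i))
  length-concatMap-tabulate {zero}  h g = refl
  length-concatMap-tabulate {suc n} h g =
    trans (length-++ (h (g 0F))) (cong (length (h (g 0F)) +_) (length-concatMap-tabulate h (g ∘ sucF)))

indicator : Bool → ℕ
indicator true  = 1
indicator false = 0

count : ∀ {n} {P : Fin n → Set} → Decidable P → ℕ
count {n} P? = ∑[ i < n ] indicator (does (P? i))

module _ {n} {P : Fin n → Set} (P? : Decidable P) where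

  count≡0 : (∀ i → ¬ P i) → count P? ≡ 0
  count≡0 ¬P = trans (sum-cong-≗ λ i → cong indicator (dec-false (P? i) (¬P i))) (sum-replicate-zero n)

  count-split : ∀ {Q : Fin n → Set} (Q? : Decidable Q) → count P? ≡ count (P? ∩? Q?) + count (P? ∩? ∁? Q?)
  count-split Q? = trans (sum-cong-≗ λ i → split (does (P? i)) (does (Q? i)))
                         (∑-distrib-+ (λ i → indicator (does ((P? ∩? Q?) i))) (λ i → indicator (does ((P? ∩? ∁? Q?) i))))
    where
    split : ∀ p q → indicator p ≡ indicator (p ∧ q) + indicator (p ∧ not q)
    split false _     = refl
    split true  true  = refl
    split true  false = refl

  count-pos : ∀ {i} → P i → 1 ≤ count P?
  count-pos {i} Pi = ℕ.≤-trans (ℕ.≤-reflexive (sym (cong indicator (dec-true (P? i) Pi))))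
                               (term≤∑ (λ j → indicator (does (P? j))) i)

count-remove : ∀ {n} {P : Fin n → Set} (P? : Decidable P) {i} → P i → suc (count (P? ∩? ∁? (_≟ i))) ≤ count P?
count-remove P? {i} Pi = begin
  1 + count (P? ∩? ∁? (_≟ i))                       ≤⟨ ℕ.+-monoˡ-≤ _ (count-pos (P? ∩? (_≟ i)) (Pi , refl)) ⟩
  count (P? ∩? (_≟ i)) + count (P? ∩? ∁? (_≟ i))    ≡⟨ count-split P? (_≟ i) ⟨
  count P?                                          ∎
  where open ℕ.≤-Reasoning

count≤1 : ∀ {n} {P : Fin n → Set} (P? : Decidable P) → (∀ {i j} → P i → P j → i ≡ j) → count P? ≤ 1
count≤1 {zero}  P? unique = z≤n
count≤1 {suc n} P? unique with P? 0F
... | yes P0 = ℕ.≤-reflexive (cong suc (count≡0 (P? ∘ sucF) λ i Pi → 0≢1+n (unique P0 Pi)))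
... | no _   = count≤1 (P? ∘ sucF) λ Pi Pj → suc-injective (unique Pi Pj)

count≤length : ∀ {n} {A : Set} (_≟ᴬ_ : DecidableEquality A) {P : Fin n → Set} (P? : Decidable P)
               (φ : Fin n → A) (xs : List A) → (∀ {i} → P i → φ i ∈ xs) →
               (∀ {i j} → P i → P j → φ i ≡ φ j → i ≡ j) → count P? ≤ length xs
count≤length _≟ᴬ_ P? φ [] into _ = ℕ.≤-reflexive (count≡0 P? λ i Pi → ¬Any[] (into Pi))
count≤length _≟ᴬ_ {P} P? φ (x ∷ xs) into injective = begin
  count P?                                   ≡⟨ count-split P? hit? ⟩
  count (P? ∩? hit?) + count (P? ∩? ∁? hit?) ≤⟨ ℕ.+-mono-≤ (count≤1 (P? ∩? hit?) at-most-one-hit)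
                                                            (count≤length _≟ᴬ_ (P? ∩? ∁? hit?) φ xs into′ misses-injective) ⟩
  1 + length xs                              ∎
  where
  open ℕ.≤-Reasoning
  hit? : Decidable (λ i → φ i ≡ x)
  hit? i = φ i ≟ᴬ x
  at-most-one-hit : ∀ {i j} → (P ∩ (λ k → φ k ≡ x)) i → (P ∩ (λ k → φ k ≡ x)) j → i ≡ j
  at-most-one-hit (Pi , i↦x) (Pj , j↦x) = injective Pi Pj (trans i↦x (sym j↦x))
  misses-injective : ∀ {i j} → (P ∩ ∁ (λ k → φ k ≡ x)) i → (P ∩ ∁ (λ k → φ k ≡ x)) j → φ i ≡ φ j → i ≡ j
  misses-injective (Pi , _) (Pj , _) = injective Pi Pj
  into′ : ∀ {i} → (P ∩ ∁ (λ j → φ j ≡ x)) i → φ i ∈ xs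
  into′ (Pi , i↛x) with into Pi
  ... | here i↦x  = ⊥-elim (i↛x i↦x)
  ... | there i∈xs = i∈xs

record RainbowC4 {n} (G : ColoredGraph n) (a b c d : Fin n) : Set where
  constructor mkRainbowC4
  field
    a≢b : a ≢ b
    a≢c : a ≢ c
    a≢d : a ≢ d
    b≢c : b ≢ c
    b≢d : b ≢ d
    c≢d : c ≢ d
    ab : adj G a b ≡ true
    bc : adj G b c ≡ true
    cd : adj G c d ≡ true
    da : adj G d a ≡ true
    ab≢bc : col G a b ≢ col G b c
    ab≢cd : col G a b ≢ col G c d
    ab≢da : col G a b ≢ col G d a
    bc≢cd : col G b c ≢ col G c d
    bc≢da : col G b c ≢ col G d a
    cd≢da : col G c d ≢ col G d a

module ColoredGraphProperties {n} (G : ColoredGraph n) where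

  adj⇒≢ : ∀ {u v} → adj G u v ≡ true → u ≢ v
  adj⇒≢ {u} uv refl with () ← trans (sym uv) (irrefl G u)

  adj-sym : ∀ {u v} → adj G u v ≡ true → adj G v u ≡ true
  adj-sym {u} {v} uv = trans (sym (adjSym G u v)) uv

  col-sym : ∀ {u v} → adj G u v ≡ true → col G u v ≡ col G v u
  col-sym {u} {v} = colSym G u v

  col≢ : ∀ {u v w} → adj G u v ≡ true → adj G u w ≡ true → v ≢ w → col G u v ≢ col G u w
  col≢ {u} {v} {w} = proper G u v w

  col-injective : ∀ {u v w} → adj G u v ≡ true → adj G u w ≡ true → col G u v ≡ col G u w → v ≡ w
  col-injective {u} {v} {w} uv uw eq = decidable-stable (v ≟ w) λ v≢w → col≢ uv uw v≢w eq

  successive-col≢ : ∀ {u v w} → adj G u v ≡ true → adj G v w ≡ true → u ≢ w → col G u v ≢ col G v w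
  successive-col≢ uv vw u≢w = col≢ (adj-sym uv) vw u≢w ∘ trans (sym (col-sym uv))

  adj? : ∀ u v → Dec (adj G u v ≡ true)
  adj? u v = map′ (Equivalence.to Bool.T-≡) (Equivalence.from Bool.T-≡) (T? (adj G u v))

  rainbowP4 : ∀ v₀ v₁ v₂ v₃ v₄ →
              v₀ ≢ v₂ → v₀ ≢ v₃ → v₀ ≢ v₄ → v₁ ≢ v₃ → v₁ ≢ v₄ → v₂ ≢ v₄ →
              adj G v₀ v₁ ≡ true → adj G v₁ v₂ ≡ true → adj G v₂ v₃ ≡ true → adj G v₃ v₄ ≡ true →
              col G v₀ v₁ ≢ col G v₂ v₃ → col G v₀ v₁ ≢ col G v₃ v₄ → col G v₁ v₂ ≢ col G v₃ v₄ →
              HasRainbowP4 G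
  rainbowP4 v₀ v₁ v₂ v₃ v₄ v₀≢v₂ v₀≢v₃ v₀≢v₄ v₁≢v₃ v₁≢v₄ v₂≢v₄ e₁ e₂ e₃ e₄ c₁≢c₃ c₁≢c₄ c₂≢c₄ =
    v₀ , v₁ , v₂ , v₃ , v₄ ,
    (adj⇒≢ e₁ , v₀≢v₂ , v₀≢v₃ , v₀≢v₄ , adj⇒≢ e₂ , v₁≢v₃ , v₁≢v₄ , adj⇒≢ e₃ , v₂≢v₄ , adj⇒≢ e₄) ,
    (e₁ , e₂ , e₃ , e₄) ,
    (successive-col≢ e₁ e₂ v₀≢v₂ , c₁≢c₃ , c₁≢c₄ , successive-col≢ e₂ e₃ v₁≢v₃ , c₂≢c₄ , successive-col≢ e₃ e₄ v₂≢v₄)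

  rotate : ∀ {a b c d} → RainbowC4 G a b c d → RainbowC4 G b c d a
  rotate (mkRainbowC4 a≢b a≢c a≢d b≢c b≢d c≢d ab bc cd da ab≢bc ab≢cd ab≢da bc≢cd bc≢da cd≢da) =
    mkRainbowC4 b≢c b≢d (≢-sym a≢b) c≢d (≢-sym a≢c) (≢-sym a≢d) bc cd da ab
                bc≢cd bc≢da (≢-sym ab≢bc) cd≢da (≢-sym ab≢cd) (≢-sym ab≢da)

  reverse : ∀ {a b c d} → RainbowC4 G a b c d → RainbowC4 G a d c b
  reverse {a} {b} {c} {d} (mkRainbowC4 a≢b a≢c a≢d b≢c b≢d c≢d ab bc cd da ab≢bc ab≢cd ab≢da bc≢cd bc≢da cd≢da) =
    mkRainbowC4 a≢d a≢c a≢b (≢-sym c≢d) (≢-sym b≢d) (≢-sym b≢c) (adj-sym da) (adj-sym cd) (adj-sym bc) (adj-sym ab)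
                (subst₂ _≢_ da≡ad cd≡dc (≢-sym cd≢da)) (subst₂ _≢_ da≡ad bc≡cb (≢-sym bc≢da))
                (subst₂ _≢_ da≡ad ab≡ba (≢-sym ab≢da)) (subst₂ _≢_ cd≡dc bc≡cb (≢-sym bc≢cd))
                (subst₂ _≢_ cd≡dc ab≡ba (≢-sym ab≢cd)) (subst₂ _≢_ bc≡cb ab≡ba (≢-sym ab≢bc))
    where
    ab≡ba : col G a b ≡ col G b a
    ab≡ba = col-sym ab
    bc≡cb : col G b c ≡ col G c b
    bc≡cb = col-sym bc
    cd≡dc : col G c d ≡ col G d c
    cd≡dc = col-sym cd
    da≡ad : col G d a ≡ col G a d
    da≡ad = col-sym da

-- The conjuncts come in the order of isRainbowC4, so does (rainbowC4? G a b c d) is definitionally isRainbowC4 G a b c d.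
rainbowC4? : ∀ {n} (G : ColoredGraph n) a b c d → Dec (RainbowC4 G a b c d)
rainbowC4? G a b c d = map′
  (λ (p₁ , p₂ , p₃ , p₄ , p₅ , p₆ , p₇ , p₈ , p₉ , p₁₀ , p₁₁ , p₁₂ , p₁₃ , p₁₄ , p₁₅ , p₁₆) →
     mkRainbowC4 p₁ p₂ p₃ p₄ p₅ p₆ p₇ p₈ p₉ p₁₀ p₁₁ p₁₂ p₁₃ p₁₄ p₁₅ p₁₆)
  (λ (mkRainbowC4 p₁ p₂ p₃ p₄ p₅ p₆ p₇ p₈ p₉ p₁₀ p₁₁ p₁₂ p₁₃ p₁₄ p₁₅ p₁₆) →
     (p₁ , p₂ , p₃ , p₄ , p₅ , p₆ , p₇ , p₈ , p₉ , p₁₀ , p₁₁ , p₁₂ , p₁₃ , p₁₄ , p₁₅ , p₁₆))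
  (¬? (a ≟ b) ×-dec ¬? (a ≟ c) ×-dec ¬? (a ≟ d) ×-dec ¬? (b ≟ c) ×-dec ¬? (b ≟ d) ×-dec ¬? (c ≟ d) ×-dec
   adj? a b ×-dec adj? b c ×-dec adj? c d ×-dec adj? d a ×-dec
   ¬? (col G a b ℕ.≟ col G b c) ×-dec ¬? (col G a b ℕ.≟ col G c d) ×-dec ¬? (col G a b ℕ.≟ col G d a) ×-dec
   ¬? (col G b c ℕ.≟ col G c d) ×-dec ¬? (col G b c ℕ.≟ col G d a) ×-dec ¬? (col G c d ℕ.≟ col G d a))
  where open ColoredGraphProperties G using (adj?)

rainbowC4At : ∀ {n} → ColoredGraph n → Fin n → ℕ
rainbowC4At {n} G a = ∑[ b < n ] ∑[ c < n ] count (rainbowC4? G a b c)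

-- The statement is length (wrap (isRainbowC4 G a b c d)) ≡ indicator (isRainbowC4 G a b c d), where wrap is
-- the Bool → List Bool helper local to rainbowC4Embeddings; it cannot be named here, so the type is inferred
-- from the use in rainbowC4Embeddings≡∑.
length-wrap : ∀ {n} (G : ColoredGraph n) (a b c d : Fin n) → _

rainbowC4Embeddings≡∑ : ∀ {n} (G : ColoredGraph n) → rainbowC4Embeddings G ≡ ∑[ a < n ] rainbowC4At G a
rainbowC4Embeddings≡∑ G =
  length-concatMap-allFin _ λ a → length-concatMap-allFin _ λ b → length-concatMap-allFin _ λ c →
  length-concatMap-allFin _ λ d → length-wrap G a b c d

length-wrap G a b c d with isRainbowC4 G a b c d
... | true  = refl
... | false = refl

rainbowP4? : ∀ {n} (G : ColoredGraph n) v₀ v₁ v₂ v₃ v₄ → Dec (RainbowP4 G v₀ v₁ v₂ v₃ v₄)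
rainbowP4? G v₀ v₁ v₂ v₃ v₄ =
  (¬? (v₀ ≟ v₁) ×-dec ¬? (v₀ ≟ v₂) ×-dec ¬? (v₀ ≟ v₃) ×-dec ¬? (v₀ ≟ v₄) ×-dec ¬? (v₁ ≟ v₂) ×-dec
   ¬? (v₁ ≟ v₃) ×-dec ¬? (v₁ ≟ v₄) ×-dec ¬? (v₂ ≟ v₃) ×-dec ¬? (v₂ ≟ v₄) ×-dec ¬? (v₃ ≟ v₄)) ×-dec
  (adj? v₀ v₁ ×-dec adj? v₁ v₂ ×-dec adj? v₂ v₃ ×-dec adj? v₃ v₄) ×-dec
  (¬? (col G v₀ v₁ ℕ.≟ col G v₁ v₂) ×-dec ¬? (col G v₀ v₁ ℕ.≟ col G v₂ v₃) ×-dec ¬? (col G v₀ v₁ ℕ.≟ col G v₃ v₄) ×-dec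
   ¬? (col G v₁ v₂ ℕ.≟ col G v₂ v₃) ×-dec ¬? (col G v₁ v₂ ℕ.≟ col G v₃ v₄) ×-dec ¬? (col G v₂ v₃ ℕ.≟ col G v₃ v₄))
  where open ColoredGraphProperties G using (adj?)

module RainbowP4Free {n} (G : ColoredGraph n) (rainbowP4-free : ¬ HasRainbowP4 G) where
  open ColoredGraphProperties G
  open RainbowC4

  outer-neighbour-col : ∀ {a b c d v} → RainbowC4 G a b c d → adj G a v ≡ true → v ≢ b → v ≢ c → v ≢ d →
                        col G a v ≡ col G b c ⊎ col G a v ≡ col G c d
  outer-neighbour-col {a} {b} {c} {d} {v} W av v≢b v≢c v≢d
    with col G a v ℕ.≟ col G b c | col G a v ℕ.≟ col G c d
  ... | yes av≡bc | _         = inj₁ av≡bc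
  ... | no _      | yes av≡cd = inj₂ av≡cd
  ... | no av≢bc  | no av≢cd  = ⊥-elim (rainbowP4-free (rainbowP4 v a b c d v≢b v≢c v≢d (a≢c W) (a≢d W) (b≢d W)
          (adj-sym av) (ab W) (bc W) (cd W)
          (subst₂ _≢_ (col-sym av) refl av≢bc) (subst₂ _≢_ (col-sym av) refl av≢cd) (ab≢cd W)))

  outer-colour : ∀ {a b c d v} → RainbowC4 G a b c d → adj G a v ≡ true → v ≢ c →
                 col G a v ∈ col G a b ∷ col G b c ∷ col G c d ∷ col G a d ∷ []
  outer-colour {b = b} {d = d} {v} W av v≢c with v ≟ b | v ≟ d
  ... | yes refl | _        = here refl
  ... | no _     | yes refl = there (there (there (here refl)))
  ... | no v≢b   | no v≢d with outer-neighbour-col W av v≢b v≢c v≢d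
  ...   | inj₁ av≡bc = there (here av≡bc)
  ...   | inj₂ av≡cd = there (there (here av≡cd))

  module Chord {a b c d x} (W : RainbowC4 G a b c d) (ac : adj G a c ≡ true)
               (ax : adj G a x ≡ true) (ax≡bc : col G a x ≡ col G b c) where

    x≢a : x ≢ a
    x≢a = ≢-sym (adj⇒≢ ax)

    x≢b : x ≢ b
    x≢b refl = ab≢bc W ax≡bc

    x≢d : x ≢ d
    x≢d refl = bc≢da W (trans (sym ax≡bc) (col-sym ax))

    ac≢bc : col G a c ≢ col G b c
    ac≢bc ac≡bc = col≢ (adj-sym ac) (adj-sym (bc W)) (a≢b W) (trans (sym (col-sym ac)) (trans ac≡bc (col-sym (bc W))))

    x≢c : x ≢ c
    x≢c refl = ac≢bc ax≡bc

    xa≡bc : col G x a ≡ col G b c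
    xa≡bc = trans (sym (col-sym ax)) ax≡bc

    no-C4-via-b : ∀ {c'} → ¬ RainbowC4 G a c c' b
    no-C4-via-b {c'} E with c' ≟ x
    ... | yes refl = rainbowP4-free (rainbowP4 b a x c d (≢-sym x≢b) (b≢c W) (b≢d W) (a≢c W) (a≢d W) x≢d
          (adj-sym (ab W)) ax (adj-sym (bc E)) (cd W)
          (subst₂ _≢_ refl (col-sym (bc E)) (≢-sym (bc≢da E)))
          (subst₂ _≢_ (col-sym (ab W)) refl (ab≢cd W))
          (subst₂ _≢_ (sym ax≡bc) refl (bc≢cd W)))
    ... | no c'≢x = rainbowP4-free (rainbowP4 x a b c' c x≢b (≢-sym c'≢x) x≢c (a≢c E) (a≢c W) (b≢c W)
          (adj-sym ax) (ab W) (adj-sym (cd E)) (adj-sym (bc E))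
          (subst₂ _≢_ (sym xa≡bc) refl (col≢ (bc W) (adj-sym (cd E)) (b≢c E)))
          (subst₂ _≢_ (trans (col-sym (adj-sym (bc W))) (sym xa≡bc)) (col-sym (bc E))
                      (col≢ (adj-sym (bc W)) (bc E) (≢-sym (c≢d E))))
          (subst₂ _≢_ (col-sym (adj-sym (ab W))) (col-sym (bc E)) (≢-sym (bc≢da E))))

    no-C4-via-x : ∀ {c'} → ¬ RainbowC4 G a c c' x
    no-C4-via-x {c'} E with c' ≟ d
    ... | yes refl = rainbowP4-free (rainbowP4 b c a d x (≢-sym (a≢b W)) (b≢d W) (≢-sym x≢b) (c≢d W) (≢-sym x≢c) (≢-sym x≢a)
          (bc W) (adj-sym ac) (adj-sym (da W)) (cd E)
          (subst₂ _≢_ refl (col-sym (da W)) (bc≢da W))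
          (subst₂ _≢_ xa≡bc (col-sym (adj-sym (cd E))) (col≢ (da E) (adj-sym (cd E)) (a≢d W)))
          (subst₂ _≢_ (col-sym ac) refl (ab≢cd E)))
    ... | no c'≢d with col G x c' ℕ.≟ col G c d
    ...   | no xc'≢cd = rainbowP4-free (rainbowP4 d c a x c' (≢-sym (a≢d W)) (≢-sym x≢d) (≢-sym c'≢d) (≢-sym x≢c) (b≢c E) (a≢c E)
            (adj-sym (cd W)) (adj-sym ac) ax (adj-sym (cd E))
            (subst₂ _≢_ (col-sym (cd W)) (sym ax≡bc) (≢-sym (bc≢cd W)))
            (subst₂ _≢_ (col-sym (cd W)) refl (≢-sym xc'≢cd))
            (subst₂ _≢_ (col-sym ac) (col-sym (cd E)) (ab≢cd E)))
    ...   | yes xc'≡cd with col G c' c ℕ.≟ col G a b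
    ...     | no c'c≢ab = rainbowP4-free (rainbowP4 b a x c' c (≢-sym x≢b) (≢-sym c'≢b) (b≢c W) (a≢c E) (a≢c W) x≢c
              (adj-sym (ab W)) ax (adj-sym (cd E)) (adj-sym (bc E))
              (subst₂ _≢_ (col-sym (ab W)) (sym xc'≡cd) (ab≢cd W))
              (subst₂ _≢_ (col-sym (ab W)) refl (≢-sym c'c≢ab))
              (subst₂ _≢_ (col-sym (da E)) (col-sym (bc E)) (≢-sym (bc≢da E))))
      where
      c'≢b : c' ≢ b
      c'≢b refl = bc≢da E (trans (col-sym (adj-sym (bc W))) (sym xa≡bc))
    ...     | yes c'c≡ab = rainbowP4-free (rainbowP4 d a x c' c (≢-sym x≢d) (≢-sym c'≢d) (≢-sym (c≢d W)) (a≢c E) (a≢c W) x≢c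
              (da W) ax (adj-sym (cd E)) (adj-sym (bc E))
              (subst₂ _≢_ refl (sym xc'≡cd) (≢-sym (cd≢da W)))
              (subst₂ _≢_ refl (sym c'c≡ab) (≢-sym (ab≢da W)))
              (subst₂ _≢_ (sym ax≡bc) (sym c'c≡ab) (≢-sym (ab≢bc W))))

  chord-not-second : ∀ {a b c d x y} → RainbowC4 G a b c d → adj G a c ≡ true →
                     adj G a x ≡ true → col G a x ≡ col G b c → adj G a y ≡ true → col G a y ≡ col G d c →
                     ∀ {c' d'} → ¬ RainbowC4 G a c c' d'
  chord-not-second {b = b} {d = d} W ac ax ax≡bc ay ay≡dc {c'} {d'} E with d' ≟ b | d' ≟ d
  ... | yes refl | _        = Chord.no-C4-via-b W ac ax ax≡bc E
  ... | no _     | yes refl = Chord.no-C4-via-b (reverse W) ac ay ay≡dc E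
  ... | no d'≢b  | no d'≢d with outer-neighbour-col W (adj-sym (da E)) d'≢b (≢-sym (b≢d E)) d'≢d
  ...   | inj₁ ad'≡bc = Chord.no-C4-via-x W ac ax ax≡bc
          (subst (RainbowC4 G _ _ c') (col-injective (adj-sym (da E)) ax (trans ad'≡bc (sym ax≡bc))) E)
  ...   | inj₂ ad'≡cd = Chord.no-C4-via-x (reverse W) ac ay ay≡dc
          (subst (RainbowC4 G _ _ c') (col-injective (adj-sym (da E)) ay (trans ad'≡cd (trans (col-sym (cd W)) (sym ay≡dc)))) E)

  record C4Cover (a : Fin n) : Set₁ where
    field
      S      : Fin n → Set
      S?     : Decidable S
      size   : count S? ≤ 4
      second : ∀ {b c d} → RainbowC4 G a b c d → S b

    fourth : ∀ {b c d} → RainbowC4 G a b c d → S d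
    fourth = second ∘ reverse

  neighbour-cover : ∀ {a} {S : Fin n → Set} (S? : Decidable S) → (∀ {v} → S v → adj G a v ≡ true) →
                    (xs : List ℕ) → length xs ≤ 4 → (∀ {v} → S v → col G a v ∈ xs) →
                    (∀ {b c d} → RainbowC4 G a b c d → S b) → C4Cover a
  neighbour-cover S? S⊆N xs |xs|≤4 into second = record
    { S? = S? ; second = second
    ; size = ℕ.≤-trans (count≤length ℕ._≟_ S? _ xs into λ Su Sv → col-injective (S⊆N Su) (S⊆N Sv)) |xs|≤4 }

  repeat? : ∀ a b c → Dec (∃ λ x → adj G a x ≡ true × col G a x ≡ col G b c)
  repeat? a b c = any? λ x → adj? a x ×-dec (col G a x ℕ.≟ col G b c)

  cover-without-repeat : ∀ {a b c d} → RainbowC4 G a b c d → adj G a c ≡ true →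
                         ¬ (∃ λ x → adj G a x ≡ true × col G a x ≡ col G b c) → C4Cover a
  cover-without-repeat {a} {b} {c} {d} W ac ∄x =
    neighbour-cover (adj? a) id (col G a b ∷ col G a c ∷ col G c d ∷ col G a d ∷ []) ℕ.≤-refl into ab
    where
    into : ∀ {v} → adj G a v ≡ true → col G a v ∈ col G a b ∷ col G a c ∷ col G c d ∷ col G a d ∷ []
    into {v} av with v ≟ c
    ... | yes refl = there (here refl)
    ... | no v≢c with outer-colour W av v≢c
    ...   | here av≡ab          = here av≡ab
    ...   | there (here av≡bc)  = ⊥-elim (∄x (v , av , av≡bc))
    ...   | there (there av∈xs) = there (there av∈xs)

  cover-from : ∀ {a b c d} → RainbowC4 G a b c d → C4Cover a
  cover-from {a} {b} {c} {d} W with adj? a c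
  ... | no ¬ac = neighbour-cover (adj? a) id _ ℕ.≤-refl (λ av → outer-colour W av λ { refl → ¬ac av }) ab
  ... | yes ac with repeat? a b c | repeat? a d c
  ...   | no ∄x | _     = cover-without-repeat W ac ∄x
  ...   | yes _ | no ∄y = cover-without-repeat (reverse W) ac ∄y
  ...   | yes (x , ax , ax≡bc) | yes (y , ay , ay≡dc) =
          neighbour-cover (λ v → adj? a v ×-dec ¬? (v ≟ c)) proj₁ _ ℕ.≤-refl (λ (av , v≢c) → outer-colour W av v≢c)
            λ E → ab E , λ { refl → chord-not-second W ac ax ax≡bc ay ay≡dc E }

  cover : ∀ a → C4Cover a
  cover a with any? (λ b → any? λ c → any? λ d → rainbowC4? G a b c d)
  ... | yes (b , c , d , W) = cover-from W
  ... | no ∄W = record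
    { S? = λ _ → no id
    ; size = ℕ.≤-trans (ℕ.≤-reflexive (count≡0 {n} (λ _ → no id) λ _ ())) z≤n
    ; second = λ W → ∄W (_ , _ , _ , W) }

  count-third≤2 : ∀ {a b c₀ d} → RainbowC4 G a b c₀ d → count (λ c → rainbowC4? G a b c d) ≤ 2
  count-third≤2 {a} {b} {c₀} {d} W =
    count≤length ℕ._≟_ (λ c → rainbowC4? G a b c d) (col G b) _ into λ E E' → col-injective (bc E) (bc E')
    where
    into : ∀ {c} → RainbowC4 G a b c d → col G b c ∈ col G b c₀ ∷ col G c₀ d ∷ []
    into {c} E with c ≟ c₀
    ... | yes refl = here refl
    ... | no c≢c₀ with outer-neighbour-col (rotate W) (bc E) c≢c₀ (c≢d E) (≢-sym (a≢c E))
    ...   | inj₁ bc≡c₀d = there (here bc≡c₀d)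
    ...   | inj₂ bc≡da  = ⊥-elim (bc≢da E bc≡da)

  rainbowC4At≤24 : ∀ a → rainbowC4At G a ≤ 24
  rainbowC4At≤24 a = begin
    ∑[ b < n ] ∑[ c < n ] count (rainbowC4? G a b c)
      ≡⟨ sum-cong-≗ (λ b → ∑-comm (λ c d → indicator (does (rainbowC4? G a b c d)))) ⟩
    ∑[ b < n ] ∑[ d < n ] count (λ c → rainbowC4? G a b c d)
      ≤⟨ ∑-mono-≤ seconds-bound ⟩
    ∑[ b < n ] (6 * indicator (does (S? b)))
      ≡⟨ *-distribˡ-sum 6 (λ b → indicator (does (S? b))) ⟨
    6 * count S?
      ≤⟨ ℕ.*-monoʳ-≤ 6 size ⟩
    24
      ∎
    where
    open ℕ.≤-Reasoning
    open C4Cover (cover a)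

    fourth? : ∀ b → Decidable (S ∩ ∁ (_≡ b))
    fourth? b = S? ∩? ∁? (_≟ b)

    thirds-bound : ∀ b d → count (λ c → rainbowC4? G a b c d) ≤ 2 * indicator (does (fourth? b d))
    thirds-bound b d with any? (λ c → rainbowC4? G a b c d)
    ... | yes (_ , W) = ℕ.≤-trans (count-third≤2 W)
                          (ℕ.≤-reflexive (sym (cong (λ t → 2 * indicator t) (dec-true (fourth? b d) (fourth W , ≢-sym (b≢d W))))))
    ... | no ∄c = ℕ.≤-trans (ℕ.≤-reflexive (count≡0 (λ c → rainbowC4? G a b c d) λ c W → ∄c (c , W))) z≤n

    seconds-bound : ∀ b → ∑[ d < n ] count (λ c → rainbowC4? G a b c d) ≤ 6 * indicator (does (S? b))
    seconds-bound b with S? b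
    ... | no ¬Sb = ℕ.≤-reflexive (trans (sum-cong-≗ λ d → count≡0 (λ c → rainbowC4? G a b c d) λ c W → ¬Sb (second W))
                                        (sum-replicate-zero n))
    ... | yes Sb = begin
      ∑[ d < n ] count (λ c → rainbowC4? G a b c d)   ≤⟨ ∑-mono-≤ (thirds-bound b) ⟩
      ∑[ d < n ] (2 * indicator (does (fourth? b d))) ≡⟨ *-distribˡ-sum 2 (λ d → indicator (does (fourth? b d))) ⟨
      2 * count (fourth? b)                           ≤⟨ ℕ.*-monoʳ-≤ 2 (s≤s⁻¹ (ℕ.≤-trans (count-remove S? Sb) size)) ⟩
      6                                               ∎

rainbowC4Embeddings≤ : ∀ {n} (G : ColoredGraph n) → ¬ HasRainbowP4 G → rainbowC4Embeddings G ≤ n * 24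
rainbowC4Embeddings≤ {n} G rainbowP4-free = begin
  rainbowC4Embeddings G                              ≡⟨ rainbowC4Embeddings≡∑ G ⟩
  ∑[ a < n ] rainbowC4At G a                         ≤⟨ ∑-mono-≤ (RainbowP4Free.rainbowC4At≤24 G rainbowP4-free) ⟩
  ∑[ a < n ] 24                                      ≡⟨ ∑-const n 24 ⟩
  n * 24                                             ∎
  where open ℕ.≤-Reasoning

record Embedding {m N} (G : ColoredGraph m) (U : ColoredGraph N) : Set where
  field
    ι         : Fin m → Fin N
    injective : ∀ {i j} → ι i ≡ ι j → i ≡ j
    adj-ι     : ∀ i j → adj U (ι i) (ι j) ≡ adj G i j
    col-ι     : ∀ i j → col U (ι i) (ι j) ≡ col G i j

  private
    ≢-ι : ∀ {i j} → i ≢ j → ι i ≢ ι j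
    ≢-ι i≢j = i≢j ∘ injective

    edge-ι : ∀ {i j} → adj G i j ≡ true → adj U (ι i) (ι j) ≡ true
    edge-ι = trans (adj-ι _ _)

    edge-ι⁻¹ : ∀ {i j} → adj U (ι i) (ι j) ≡ true → adj G i j ≡ true
    edge-ι⁻¹ = trans (sym (adj-ι _ _))

    col≢-ι : ∀ {i j k l} → col G i j ≢ col G k l → col U (ι i) (ι j) ≢ col U (ι k) (ι l)
    col≢-ι = subst₂ _≢_ (sym (col-ι _ _)) (sym (col-ι _ _))

    col≢-ι⁻¹ : ∀ {i j k l} → col U (ι i) (ι j) ≢ col U (ι k) (ι l) → col G i j ≢ col G k l
    col≢-ι⁻¹ = subst₂ _≢_ (col-ι _ _) (col-ι _ _)

  rainbowC4-ι : ∀ {a b c d} → RainbowC4 U (ι a) (ι b) (ι c) (ι d) ⇔ RainbowC4 G a b c d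
  rainbowC4-ι = mk⇔
    (λ (mkRainbowC4 a≢b a≢c a≢d b≢c b≢d c≢d ab bc cd da ab≢bc ab≢cd ab≢da bc≢cd bc≢da cd≢da) →
       mkRainbowC4 (a≢b ∘ cong ι) (a≢c ∘ cong ι) (a≢d ∘ cong ι) (b≢c ∘ cong ι) (b≢d ∘ cong ι) (c≢d ∘ cong ι)
                   (edge-ι⁻¹ ab) (edge-ι⁻¹ bc) (edge-ι⁻¹ cd) (edge-ι⁻¹ da)
                   (col≢-ι⁻¹ ab≢bc) (col≢-ι⁻¹ ab≢cd) (col≢-ι⁻¹ ab≢da) (col≢-ι⁻¹ bc≢cd) (col≢-ι⁻¹ bc≢da) (col≢-ι⁻¹ cd≢da))
    (λ (mkRainbowC4 a≢b a≢c a≢d b≢c b≢d c≢d ab bc cd da ab≢bc ab≢cd ab≢da bc≢cd bc≢da cd≢da) →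
       mkRainbowC4 (≢-ι a≢b) (≢-ι a≢c) (≢-ι a≢d) (≢-ι b≢c) (≢-ι b≢d) (≢-ι c≢d)
                   (edge-ι ab) (edge-ι bc) (edge-ι cd) (edge-ι da)
                   (col≢-ι ab≢bc) (col≢-ι ab≢cd) (col≢-ι ab≢da) (col≢-ι bc≢cd) (col≢-ι bc≢da) (col≢-ι cd≢da))

  rainbowP4-ι⁻¹ : ∀ {v₀ v₁ v₂ v₃ v₄} → RainbowP4 U (ι v₀) (ι v₁) (ι v₂) (ι v₃) (ι v₄) → RainbowP4 G v₀ v₁ v₂ v₃ v₄
  rainbowP4-ι⁻¹ ((d₀₁ , d₀₂ , d₀₃ , d₀₄ , d₁₂ , d₁₃ , d₁₄ , d₂₃ , d₂₄ , d₃₄) , (e₁ , e₂ , e₃ , e₄) ,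
                 (k₁₂ , k₁₃ , k₁₄ , k₂₃ , k₂₄ , k₃₄)) =
    (d₀₁ ∘ cong ι , d₀₂ ∘ cong ι , d₀₃ ∘ cong ι , d₀₄ ∘ cong ι , d₁₂ ∘ cong ι ,
     d₁₃ ∘ cong ι , d₁₄ ∘ cong ι , d₂₃ ∘ cong ι , d₂₄ ∘ cong ι , d₃₄ ∘ cong ι) ,
    (edge-ι⁻¹ e₁ , edge-ι⁻¹ e₂ , edge-ι⁻¹ e₃ , edge-ι⁻¹ e₄) ,
    (col≢-ι⁻¹ k₁₂ , col≢-ι⁻¹ k₁₃ , col≢-ι⁻¹ k₁₄ , col≢-ι⁻¹ k₂₃ , col≢-ι⁻¹ k₂₄ , col≢-ι⁻¹ k₃₄)

record Component {m N} (G : ColoredGraph m) (U : ColoredGraph N) : Set where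
  field
    embedding : Embedding G U
    m′        : ℕ
    ι′        : Fin m′ → Fin N
  open Embedding embedding public
  field
    ∑-split : ∀ f → sum f ≡ sum (f ∘ ι) + sum (f ∘ ι′)
    apart   : ∀ i j → adj U (ι i) (ι′ j) ≡ false
    locate  : ∀ w → (∃ λ i → ι i ≡ w) ⊎ (∃ λ j → ι′ j ≡ w)

  ¬adj-ι′ : ∀ {i j} → adj U (ι i) (ι′ j) ≢ true
  ¬adj-ι′ {i} {j} e with () ← trans (sym e) (apart i j)

  neighbour-ι : ∀ {i w} → adj U (ι i) w ≡ true → ∃ λ j → ι j ≡ w
  neighbour-ι {i} {w} e with locate w
  ... | inj₁ inside     = inside
  ... | inj₂ (j , refl) = ⊥-elim (¬adj-ι′ e)

  rainbowP4-component : ∀ {i v₁ v₂ v₃ v₄} → RainbowP4 U (ι i) v₁ v₂ v₃ v₄ → HasRainbowP4 G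
  rainbowP4-component {i} P@(_ , (e₁ , e₂ , e₃ , e₄) , _) with neighbour-ι e₁
  ... | i₁ , refl with neighbour-ι e₂
  ... | i₂ , refl with neighbour-ι e₃
  ... | i₃ , refl with neighbour-ι e₄
  ... | i₄ , refl = i , i₁ , i₂ , i₃ , i₄ , rainbowP4-ι⁻¹ P

  sum-ι : (f : Fin N → ℕ) → (∀ j → f (ι′ j) ≡ 0) → sum f ≡ sum (f ∘ ι)
  sum-ι f vanishes = begin
    sum f                       ≡⟨ ∑-split f ⟩
    sum (f ∘ ι) + sum (f ∘ ι′)  ≡⟨ cong (sum (f ∘ ι) +_) (trans (sum-cong-≗ vanishes) (sum-replicate-zero m′)) ⟩
    sum (f ∘ ι) + 0             ≡⟨ ℕ.+-identityʳ _ ⟩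
    sum (f ∘ ι)                 ∎
    where open ≡-Reasoning

  rainbowC4At-ι : ∀ a → rainbowC4At U (ι a) ≡ rainbowC4At G a
  rainbowC4At-ι a = begin
    ∑[ b < N ] ∑[ c < N ] count (rainbowC4? U (ι a) b c)
      ≡⟨ sum-ι _ (λ j → trans (sum-cong-≗ λ c → count≡0 (rainbowC4? U (ι a) (ι′ j) c) λ _ W → ¬adj-ι′ (ab W))
                              (sum-replicate-zero N)) ⟩
    ∑[ b < m ] ∑[ c < N ] count (rainbowC4? U (ι a) (ι b) c)
      ≡⟨ sum-cong-≗ (λ b → sum-ι _ λ j → count≡0 (rainbowC4? U (ι a) (ι b) (ι′ j)) λ _ W → ¬adj-ι′ (bc W)) ⟩
    ∑[ b < m ] ∑[ c < m ] count (rainbowC4? U (ι a) (ι b) (ι c))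
      ≡⟨ sum-cong-≗ (λ b → sum-cong-≗ λ c → sum-ι _ λ j →
           cong indicator (dec-false (rainbowC4? U (ι a) (ι b) (ι c) (ι′ j)) λ W → ¬adj-ι′ (cd W))) ⟩
    ∑[ b < m ] ∑[ c < m ] ∑[ d < m ] indicator (does (rainbowC4? U (ι a) (ι b) (ι c) (ι d)))
      ≡⟨ sum-cong-≗ (λ b → sum-cong-≗ λ c → sum-cong-≗ λ d →
           cong indicator (does-⇔ rainbowC4-ι (rainbowC4? U _ _ _ _) (rainbowC4? G a b c d))) ⟩
    rainbowC4At G a
      ∎
    where
    open ≡-Reasoning
    open RainbowC4

module _ {m n} (G : ColoredGraph m) (H : ColoredGraph n) where

  private
    adj⊎ : Fin m ⊎ Fin n → Fin m ⊎ Fin n → Bool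
    adj⊎ (inj₁ i) (inj₁ j) = adj G i j
    adj⊎ (inj₂ i) (inj₂ j) = adj H i j
    adj⊎ _        _        = false

    col⊎ : Fin m ⊎ Fin n → Fin m ⊎ Fin n → ℕ
    col⊎ (inj₁ i) (inj₁ j) = col G i j
    col⊎ (inj₂ i) (inj₂ j) = col H i j
    col⊎ _        _        = 0

    adj⊎-sym : ∀ x y → adj⊎ x y ≡ adj⊎ y x
    adj⊎-sym (inj₁ i) (inj₁ j) = adjSym G i j
    adj⊎-sym (inj₁ i) (inj₂ j) = refl
    adj⊎-sym (inj₂ i) (inj₁ j) = refl
    adj⊎-sym (inj₂ i) (inj₂ j) = adjSym H i j

    adj⊎-irrefl : ∀ x → adj⊎ x x ≡ false
    adj⊎-irrefl (inj₁ i) = irrefl G i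
    adj⊎-irrefl (inj₂ i) = irrefl H i

    col⊎-sym : ∀ x y → adj⊎ x y ≡ true → col⊎ x y ≡ col⊎ y x
    col⊎-sym (inj₁ i) (inj₁ j) = colSym G i j
    col⊎-sym (inj₂ i) (inj₂ j) = colSym H i j

    col⊎-proper : ∀ x y z → adj⊎ x y ≡ true → adj⊎ x z ≡ true → y ≢ z → col⊎ x y ≢ col⊎ x z
    col⊎-proper (inj₁ i) (inj₁ j) (inj₁ k) ij ik y≢z = proper G i j k ij ik (y≢z ∘ cong inj₁)
    col⊎-proper (inj₂ i) (inj₂ j) (inj₂ k) ij ik y≢z = proper H i j k ij ik (y≢z ∘ cong inj₂)

    splitAt-injective : ∀ {u v} → splitAt m {n} u ≡ splitAt m v → u ≡ v
    splitAt-injective {u} {v} eq =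
      trans (sym (join-splitAt m n u)) (trans (cong (join m n) eq) (join-splitAt m n v))

    locate : ∀ w → (∃ λ i → i ↑ˡ n ≡ w) ⊎ (∃ λ j → m ↑ʳ j ≡ w)
    locate w with splitAt m w in eq
    ... | inj₁ i = inj₁ (i , splitAt⁻¹-↑ˡ eq)
    ... | inj₂ j = inj₂ (j , splitAt⁻¹-↑ʳ eq)

  _⊕_ : ColoredGraph (m + n)
  _⊕_ = record
    { adj    = λ u v → adj⊎ (splitAt m u) (splitAt m v)
    ; col    = λ u v → col⊎ (splitAt m u) (splitAt m v)
    ; adjSym = λ u v → adj⊎-sym (splitAt m u) (splitAt m v)
    ; irrefl = λ u → adj⊎-irrefl (splitAt m u)
    ; colSym = λ u v → col⊎-sym (splitAt m u) (splitAt m v)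
    ; proper = λ u v w uv uw v≢w → col⊎-proper (splitAt m u) (splitAt m v) (splitAt m w) uv uw (v≢w ∘ splitAt-injective)
    }

  ⊕-left : Component G _⊕_
  ⊕-left = record
    { embedding = record
      { ι = _↑ˡ n
      ; injective = ↑ˡ-injective n _ _
      ; adj-ι = λ i j → cong₂ adj⊎ (splitAt-↑ˡ m i n) (splitAt-↑ˡ m j n)
      ; col-ι = λ i j → cong₂ col⊎ (splitAt-↑ˡ m i n) (splitAt-↑ˡ m j n)
      }
    ; ι′ = m ↑ʳ_
    ; ∑-split = ∑-↑ m
    ; apart = λ i j → cong₂ adj⊎ (splitAt-↑ˡ m i n) (splitAt-↑ʳ m n j)
    ; locate = locate
    }

  ⊕-right : Component H _⊕_
  ⊕-right = record
    { embedding = record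
      { ι = m ↑ʳ_
      ; injective = ↑ʳ-injective m _ _
      ; adj-ι = λ i j → cong₂ adj⊎ (splitAt-↑ʳ m n i) (splitAt-↑ʳ m n j)
      ; col-ι = λ i j → cong₂ col⊎ (splitAt-↑ʳ m n i) (splitAt-↑ʳ m n j)
      }
    ; ι′ = _↑ˡ n
    ; ∑-split = λ f → trans (∑-↑ m f) (ℕ.+-comm (sum (f ∘ (_↑ˡ n))) _)
    ; apart = λ i j → cong₂ adj⊎ (splitAt-↑ʳ m n i) (splitAt-↑ˡ m j n)
    ; locate = Sum.swap ∘ locate
    }

⊕-rainbowP4-free : ∀ {m n} {G : ColoredGraph m} {H : ColoredGraph n} →
                   ¬ HasRainbowP4 G → ¬ HasRainbowP4 H → ¬ HasRainbowP4 (G ⊕ H)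
⊕-rainbowP4-free {G = G} {H} ¬G ¬H (v₀ , _ , _ , _ , _ , P) with Component.locate (⊕-left G H) v₀
... | inj₁ (_ , refl) = ¬G (Component.rainbowP4-component (⊕-left G H) P)
... | inj₂ (_ , refl) = ¬H (Component.rainbowP4-component (⊕-right G H) P)

emptyᴳ : ColoredGraph 0
emptyᴳ = record { adj = λ () ; col = λ () ; adjSym = λ () ; irrefl = λ () ; colSym = λ () ; proper = λ () }

copies : ∀ {m} q → ColoredGraph m → ColoredGraph (q * m)
copies zero    G = emptyᴳ
copies (suc q) G = G ⊕ copies q G

copies-rainbowP4-free : ∀ {m} {G : ColoredGraph m} → ¬ HasRainbowP4 G → ∀ q → ¬ HasRainbowP4 (copies q G)
copies-rainbowP4-free ¬G zero    (() , _)
copies-rainbowP4-free ¬G (suc q) = ⊕-rainbowP4-free ¬G (copies-rainbowP4-free ¬G q)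

copies-rainbowC4At : ∀ {m t} {G : ColoredGraph m} → (∀ a → rainbowC4At G a ≡ t) →
                     ∀ q a → rainbowC4At (copies q G) a ≡ t
copies-rainbowC4At {G = G} const (suc q) a with Component.locate (⊕-left G (copies q G)) a
... | inj₁ (i , refl) = trans (Component.rainbowC4At-ι (⊕-left G (copies q G)) i) (const i)
... | inj₂ (j , refl) = trans (Component.rainbowC4At-ι (⊕-right G (copies q G)) j) (copies-rainbowC4At const q j)

-- K₄,₄ as a Cayley graph of 𝔽₂³: vertex u is the vector finToFun u, u ~ v iff they differ in the first
-- coordinate, and uv is coloured by u + v.  A rainbow P4 would use all four colours, whose sum is 0, so it would
-- end where it starts; the labelled rainbow C4s starting at a vertex are the 4! orderings of the colours.
_+₂_ : Fin 2 → Fin 2 → Fin 2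
0F      +₂ y       = y
sucF 0F +₂ 0F      = sucF 0F
sucF 0F +₂ sucF 0F = 0F

K₄,₄ : ColoredGraph 8
K₄,₄ = record
  { adj    = K-adj
  ; col    = K-col
  ; adjSym = from-yes (all? λ u → all? λ v → K-adj u v Bool.≟ K-adj v u)
  ; irrefl = from-yes (all? λ u → K-adj u u Bool.≟ false)
  ; colSym = λ u v _ → from-yes (all? λ u → all? λ v → K-col u v ℕ.≟ K-col v u) u v
  ; proper = λ u v w _ _ → from-yes (all? λ u → all? λ v → all? λ w → ¬? (v ≟ w) →-dec ¬? (K-col u v ℕ.≟ K-col u w)) u v w
  }
  where
  coords : Fin 8 → Fin 3 → Fin 2
  coords = finToFun
  K-adj : Fin 8 → Fin 8 → Bool
  K-adj u v = not (does (coords u 0F ≟ coords v 0F))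
  K-col : Fin 8 → Fin 8 → ℕ
  K-col u v = toℕ (funToFin λ k → coords u k +₂ coords v k)

K₄,₄-rainbowP4-free : ¬ HasRainbowP4 K₄,₄
K₄,₄-rainbowP4-free (v₀ , v₁ , v₂ , v₃ , v₄ , P@(_ , (e₁ , e₂ , e₃ , e₄) , _)) =
  no-rainbow-walk (v₀ , v₁ , e₁ , v₂ , e₂ , v₃ , e₃ , v₄ , e₄ , P)
  where
  open ColoredGraphProperties K₄,₄ using (adj?)
  -- enumerating walks edge by edge keeps the exhaustive search small
  no-rainbow-walk : ¬ (∃ λ v₀ → ∃ λ v₁ → adj K₄,₄ v₀ v₁ ≡ true × ∃ λ v₂ → adj K₄,₄ v₁ v₂ ≡ true ×
                       ∃ λ v₃ → adj K₄,₄ v₂ v₃ ≡ true × ∃ λ v₄ → adj K₄,₄ v₃ v₄ ≡ true × RainbowP4 K₄,₄ v₀ v₁ v₂ v₃ v₄)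
  no-rainbow-walk = from-yes (¬? (any? λ v₀ → any? λ v₁ → adj? v₀ v₁ ×-dec any? λ v₂ → adj? v₁ v₂ ×-dec
                                  any? λ v₃ → adj? v₂ v₃ ×-dec any? λ v₄ → adj? v₃ v₄ ×-dec rainbowP4? K₄,₄ v₀ v₁ v₂ v₃ v₄))

K₄,₄-rainbowC4At : ∀ a → rainbowC4At K₄,₄ a ≡ 24
K₄,₄-rainbowC4At = from-yes (all? λ a → rainbowC4At K₄,₄ a ℕ.≟ 24)

*24/8 : ∀ m → m * 24 / 8 ≡ 3 * m
*24/8 m = trans (cong (_/ 8) (trans (sym (ℕ.*-assoc m 3 8)) (cong (_* 8) (ℕ.*-comm m 3)))) (m*n/n≡m (3 * m) 8)

theorem9 : (n : ℕ) → 0 < n → 8 ∣ n →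
    (Σ (ColoredGraph n) λ G → ¬ HasRainbowP4 G × rainbowC4Copies G ≡ 3 * n) ×
    ((G : ColoredGraph n) → ¬ HasRainbowP4 G → rainbowC4Copies G ≤ 3 * n)
theorem9 n _ (divides q refl) = (copies q K₄,₄ , copies-rainbowP4-free K₄,₄-rainbowP4-free q , extremal) , bound
  where
  extremal : rainbowC4Copies (copies q K₄,₄) ≡ 3 * (q * 8)
  extremal = begin
    rainbowC4Embeddings (copies q K₄,₄) / 8              ≡⟨ cong (_/ 8) (rainbowC4Embeddings≡∑ (copies q K₄,₄)) ⟩
    (∑[ a < q * 8 ] rainbowC4At (copies q K₄,₄) a) / 8   ≡⟨ cong (_/ 8) (sum-cong-≗ (copies-rainbowC4At K₄,₄-rainbowC4At q)) ⟩
    (∑[ a < q * 8 ] 24) / 8                              ≡⟨ cong (_/ 8) (∑-const (q * 8) 24) ⟩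
    q * 8 * 24 / 8                                       ≡⟨ *24/8 (q * 8) ⟩
    3 * (q * 8)                                          ∎
    where open ≡-Reasoning

  bound : (G : ColoredGraph (q * 8)) → ¬ HasRainbowP4 G → rainbowC4Copies G ≤ 3 * (q * 8)
  bound G rainbowP4-free = ℕ.≤-trans (/-monoˡ-≤ 8 (rainbowC4Embeddings≤ G rainbowP4-free)) (ℕ.≤-reflexive (*24/8 (q * 8)))
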